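{- Let $k\ge 3$. In the vertex on-line ordered Ramsey game described below, builder has a strategy which ensures that, for every $n$, the colored ordered $(k-1)$-graph contains either a red copy of the ordered $(k-1)$-graph $F$ or a blue $K^{k-1}_n$ (a set of $n$ exposed vertices all of whose $(k-1)$-subsets are drawn and colored blue), using at most $s=O(n^{k-2})$ vertices, at most $r=O(n^{k-2})$ red edges, and at most $m=O(n^{2k-4})$ edges in total (the implied constants depending only on $k$).
   Context: The vertex on-line ordered Ramsey game is played by two players, builder and painter. Vertices are revealed one at a time, $v_1,v_2,\ldots$, and are ordered $v_1<v_2<\cdots$ by the time they are revealed. At stage $i+1$ a new vertex $v_{i+1}$ is revealed; then, for every $(k-2)$-subset $S$ of the existing vertices $v_1,\ldots,v_i$, builder decides, one by one, whether to draw the $(k-1)$-edge $S\cup\{v_{i+1}\}$; whenever builder draws such an edge, painter must immediately color it red or blue. $F$ is the ordered $(k-1)$-graph on vertices $a_1<a_2<\cdots<a_k$ with exactly the two edges $\{a_1,\ldots,a_{k-1}\}$ and $\{a_1,\ldots,a_{k-2},a_k\}$; a red copy of $F$ means exposed vertices $b_1<\cdots<b_k$ such that these two corresponding edges have been drawn and colored red. -}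

module Defs where

open import Data.Bool using (Bool; true; false; _∧_; not; if_then_else_)
open import Data.Nat using (ℕ; zero; suc; _<_; _<ᵇ_; _≡ᵇ_; _∸_; _≤_)
import Data.Nat as ℕ
open import Data.List using (List; []; _∷_; _++_; [_]; length; filter)
open import Data.Bool.ListAction using (all; any)
open import Data.List.Properties using (≡-dec)
open import Data.List.Relation.Unary.AllPairs using (AllPairs; allPairs?)
open import Data.List.Relation.Unary.All using (All)
open import Data.List.Membership.Propositional using (_∈_)
open import Data.Product using (_×_; _,_; proj₁; proj₂; ∃-syntax)
open import Relation.Nullary.Decidable using (⌊_⌋)
open import Relation.Binary.PropositionalEquality using (_≡_)

data Colour : Set where
  red blue : Colour

isRed : Colour → Bool
isRed red  = true
isRed blue = false

-- Vertices are natural numbers 0,1,2,...; vertex i is the (i+1)-st revealed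
-- vertex, so the vertex order is the order of ℕ.
-- A (k-1)-edge is stored as the strictly increasing list of its vertices.
Edge : Set
Edge = List ℕ

Increasing : List ℕ → Set
Increasing = AllPairs _<_

-- The state of the game = the full history:
-- number of revealed vertices and the drawn edges with colours, in drawing order.
record State : Set where
  constructor mkState
  field
    nv    : ℕ
    edges : List (Edge × Colour)
open State public

initial : State
initial = mkState 0 []

-- A builder move: reveal the next vertex, or draw the edge S ∪ {newest vertex}.
data Move : Set where
  reveal : Move
  draw   : List ℕ → Move

Builder : Set
Builder = State → Move

Painter : Set
Painter = State → Edge → Colour

newEdge : State → List ℕ → Edge
newEdge st S = S ++ [ nv st ∸ 1 ]

-- S is a legal choice: a (k-2)-subset of the older vertices v_1..v_i
-- (here 0..nv-2), and the edge S ∪ {newest} was not drawn before.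
legal : ℕ → State → List ℕ → Bool
legal k st S =
  ⌊ allPairs? Data.Nat._<?_ S ⌋
  ∧ (length S ≡ᵇ (k ∸ 2))
  ∧ all (λ x → x <ᵇ (nv st ∸ 1)) S
  ∧ not (any (λ p → ⌊ ≡-dec Data.Nat._≟_ (proj₁ p) (newEdge st S) ⌋) (edges st))
  where import Data.Nat

-- One move of the game (illegal builder moves change nothing).
step : ℕ → Builder → Painter → State → State
step k B P st with B st
... | reveal = mkState (suc (nv st)) (edges st)
... | draw S = if legal k st S
               then mkState (nv st) (edges st ++ [ (newEdge st S , P st (newEdge st S)) ])
               else st

run : ℕ → Builder → Painter → ℕ → State
run k B P zero    = initial
run k B P (suc t) = step k B P (run k B P t)

redCount : State → ℕ
redCount st = length (filter (λ p → Data.Bool._≟_ (isRed (proj₂ p)) true) (edges st))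
  where import Data.Bool

-- Red copy of F: vertices b_1<...<b_k with edges {b_1..b_{k-1}} and
-- {b_1..b_{k-2},b_k} drawn and red.  T = (b_1,...,b_{k-2}), x = b_{k-1}, y = b_k.
RedF : ℕ → State → Set
RedF k st =
  ∃[ T ] ∃[ x ] ∃[ y ]
    Increasing T × length T ≡ k ∸ 2 × All (_< x) T × x < y
    × (T ++ [ x ] , red) ∈ edges st
    × (T ++ [ y ] , red) ∈ edges st

BlueK : ℕ → ℕ → State → Set
BlueK k n st =
  ∃[ V ] Increasing V × length V ≡ n × All (_< nv st) V
    × (∀ (e : List ℕ) → Increasing e → length e ≡ k ∸ 1 → All (_∈ V) e
         → (e , blue) ∈ edges st)

-- Builder keeps the list Q of red-free vertices: those that are not the top (largest) vertex of a
-- red edge.  Right after revealing v it draws S ∪ {v} for the (k-2)-subsets S of Q, one after the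
-- other, until all are drawn or painter colours one red; then it reveals the next vertex.  Two red
-- edges with the same base S form a red F, so while there is none the bases of the red edges are
-- distinct (k-2)-subsets of Q: there are at most |Q|^(k-2) red edges.  Every vertex is red-free or
-- tops a red edge, hence v ≤ |Q| + 1 + |Q|^(k-2), and at most (v + 1)|Q|^(k-2) edges are drawn.
-- Every move increases v + #edges, so after boundedly many moves either a red F has appeared or
-- |Q| = n, and then Q spans a blue clique: an edge S ∪ {u} of Q with top u was drawn when u was
-- revealed, and it is blue because u is red-free.
module Submission where

open import Defs
open import Data.Bool using (true; false; T; not; _∧_)
import Data.Bool as Bool
open import Data.Bool.Properties using (T-∧; T-≡)
open import Data.Bool.ListAction using (any)
open import Data.Maybe using (just)
import Data.Maybe.Properties as Maybe
open import Data.Nat using (ℕ; zero; suc; _+_; _*_; _^_; _∸_; _<_; _≤_; z≤n; s≤s; >-nonZero)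
open import Data.Nat.Properties
open import Data.List
  using (List; []; _∷_; _++_; [_]; length; map; filter; last; upTo; cartesianProductWith; initLast; _∷ʳ′_)
open import Data.List.Properties
  using ( ≡-dec; length-++; length-map; length-upTo; map-++; filter-++; ++-identityʳ; upTo-∷ʳ
        ; filter-accept; filter-reject)
open import Data.List.Membership.Propositional using (_∈_; _∉_; find; lose)
open import Data.List.Membership.Propositional.Properties
  using ( ∈-∃++; ∈-++⁻; ∈-++⁺ˡ; ∈-++⁺ʳ; ∈-map⁺; ∈-map⁻; ∈-filter⁺; ∈-filter⁻; ∈-upTo⁺; ∈-upTo⁻
        ; ∈-cartesianProductWith⁺)
open import Data.List.Membership.DecPropositional (≡-dec _≟_) using (_∈?_)
open import Data.List.Relation.Unary.All using (All; []; _∷_)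
import Data.List.Relation.Unary.All as All
import Data.List.Relation.Unary.All.Properties as All
open import Data.List.Relation.Unary.AllPairs using (AllPairs; []; _∷_; allPairs?)
import Data.List.Relation.Unary.AllPairs.Properties as AllPairs
open import Data.List.Relation.Unary.Any using (Any; here; there; any?)
import Data.List.Relation.Unary.Any.Properties as Any
open import Data.List.Relation.Unary.Unique.Propositional using (Unique)
import Data.List.Relation.Unary.Unique.Propositional.Properties as Unique
open import Data.List.Relation.Binary.Subset.Propositional using (_⊆_)
open import Data.List.Relation.Binary.Sublist.Propositional
  using ([]; _∷_; _∷ʳ_; ⊆-refl; ⊆-trans) renaming (_⊆_ to _⊑_)
open import Data.List.Relation.Binary.Sublist.Propositional.Properties
  using (All-resp-⊆; Any-resp-⊆; []⊆-universal; ++⁺ʳ)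
open import Data.Product using (_×_; _,_; proj₁; proj₂; ∃₂; ∃-syntax)
open import Data.Sum using (_⊎_; inj₁; inj₂)
open import Function using (_∘_; _⇔_; mk⇔; Equivalence)
open import Relation.Binary.Core using (Rel)
open import Relation.Binary.PropositionalEquality
  using (_≡_; _≢_; refl; sym; trans; cong; cong₂; subst; subst₂; module ≡-Reasoning)
open import Relation.Nullary using (¬_; Dec; yes; no; ¬?; contradiction)
open import Relation.Nullary.Decidable using (⌊_⌋; fromWitness; toWitness)
open import Relation.Unary using (Pred; Decidable)

private variable
  A B C : Set

length-snoc : ∀ (xs : List A) {x} → length (xs ++ [ x ]) ≡ suc (length xs)
length-snoc xs = trans (length-++ xs) (+-comm (length xs) 1)

unique-⊆⇒length≤ : {xs ys : List A} → Unique xs → xs ⊆ ys → length xs ≤ length ys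
unique-⊆⇒length≤ [] _ = z≤n
unique-⊆⇒length≤ {xs = x ∷ xs} (x∉xs ∷ xs!) xs⊆ys
  with ys₁ , ys₂ , refl ← ∈-∃++ (xs⊆ys (here refl)) = begin
    suc (length xs)                ≤⟨ s≤s (unique-⊆⇒length≤ xs! xs⊆ys₁ys₂) ⟩
    suc (length (ys₁ ++ ys₂))      ≡⟨ cong suc (length-++ ys₁) ⟩
    suc (length ys₁ + length ys₂)  ≡⟨ sym (+-suc (length ys₁) (length ys₂)) ⟩
    length ys₁ + length (x ∷ ys₂)  ≡⟨ sym (length-++ ys₁) ⟩
    length (ys₁ ++ x ∷ ys₂)        ∎
  where
  open ≤-Reasoning
  xs⊆ys₁ys₂ : xs ⊆ ys₁ ++ ys₂
  xs⊆ys₁ys₂ {y} y∈xs with ∈-++⁻ ys₁ (xs⊆ys (there y∈xs))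
  ... | inj₁ y∈ys₁         = ∈-++⁺ˡ y∈ys₁
  ... | inj₂ (here refl)   = contradiction refl (All.lookup x∉xs y∈xs)
  ... | inj₂ (there y∈ys₂) = ∈-++⁺ʳ ys₁ y∈ys₂

unique-snoc : {xs : List A} {x : A} → Unique xs → x ∉ xs → Unique (xs ++ [ x ])
unique-snoc xs! x∉xs = Unique.++⁺ xs! ([] ∷ []) λ { (x∈xs , here refl) → x∉xs x∈xs }

length-cartesianProductWith : (f : A → B → C) (xs : List A) (ys : List B) →
                              length (cartesianProductWith f xs ys) ≡ length xs * length ys
length-cartesianProductWith f []       ys = refl
length-cartesianProductWith f (x ∷ xs) ys = begin
  length (map (f x) ys ++ cartesianProductWith f xs ys)          ≡⟨ length-++ (map (f x) ys) ⟩
  length (map (f x) ys) + length (cartesianProductWith f xs ys)  ≡⟨ cong₂ _+_ (length-map (f x) ys)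
                                                                           (length-cartesianProductWith f xs ys) ⟩
  length ys + length xs * length ys                              ∎
  where open ≡-Reasoning

filter-≐-on : ∀ {ℓ} {P Q : Pred A ℓ} (P? : Decidable P) (Q? : Decidable Q) {xs} →
              All (λ x → P x ⇔ Q x) xs → filter P? xs ≡ filter Q? xs
filter-≐-on P? Q? []                       = refl
filter-≐-on P? Q? {x ∷ _} (P⇔Q ∷ P⇔Q-rest) with P? x | Q? x
... | yes _  | yes _  = cong (x ∷_) (filter-≐-on P? Q? P⇔Q-rest)
... | no _   | no _   = filter-≐-on P? Q? P⇔Q-rest
... | yes px | no ¬qx = contradiction (Equivalence.to P⇔Q px) ¬qx
... | no ¬px | yes qx = contradiction (Equivalence.from P⇔Q qx) ¬px

last-snoc : ∀ (xs : List A) x → last (xs ++ [ x ]) ≡ just x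
last-snoc []           x = refl
last-snoc (_ ∷ [])     x = refl
last-snoc (_ ∷ y ∷ xs) x = last-snoc (y ∷ xs) x

last-snoc-injective : ∀ (xs : List A) {x y} → last (xs ++ [ x ]) ≡ just y → x ≡ y
last-snoc-injective xs {x} last≡ = Maybe.just-injective (trans (sym (last-snoc xs x)) last≡)

dropLast : List A → List A
dropLast []           = []
dropLast (_ ∷ [])     = []
dropLast (x ∷ y ∷ xs) = x ∷ dropLast (y ∷ xs)

dropLast-snoc : ∀ (xs : List A) x → dropLast (xs ++ [ x ]) ≡ xs
dropLast-snoc []           x = refl
dropLast-snoc (_ ∷ [])     x = refl
dropLast-snoc (z ∷ y ∷ xs) x = cong (z ∷_) (dropLast-snoc (y ∷ xs) x)

AllPairs-resp-⊒ : ∀ {ℓ} {R : Rel A ℓ} {xs ys} → ys ⊑ xs → AllPairs R xs → AllPairs R ys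
AllPairs-resp-⊒ []         []         = []
AllPairs-resp-⊒ (_ ∷ʳ τ)   (_ ∷ pxs)  = AllPairs-resp-⊒ τ pxs
AllPairs-resp-⊒ (refl ∷ τ) (px ∷ pxs) = All-resp-⊆ τ px ∷ AllPairs-resp-⊒ τ pxs

AllPairs-snoc⁻ : ∀ {ℓ} {R : Rel A ℓ} xs {x} → AllPairs R (xs ++ [ x ]) →
                 AllPairs R xs × All (λ y → R y x) xs
AllPairs-snoc⁻ []       _           = [] , []
AllPairs-snoc⁻ (y ∷ xs) (Ry ∷ Rxsx) with Rxs , xs-R-x ← AllPairs-snoc⁻ xs Rxsx =
  All.++⁻ˡ xs Ry ∷ Rxs , proj₂ (All.∷ʳ⁻ Ry) ∷ xs-R-x

∈-tail : ∀ {x z} {xs : List ℕ} → x < z → z ∈ x ∷ xs → z ∈ xs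
∈-tail x<z (here refl)  = contradiction x<z (<-irrefl refl)
∈-tail x<z (there z∈xs) = z∈xs

increasing-⊆⇒⊑ : ∀ {xs ys} → Increasing xs → Increasing ys → All (_∈ xs) ys → ys ⊑ xs
increasing-⊆⇒⊑ {xs} {[]} _ _ _ = []⊆-universal xs
increasing-⊆⇒⊑ {x ∷ xs} {y ∷ ys} (_ ∷ xs↑) (y<ys ∷ ys↑) (here refl ∷ ys∈) =
  refl ∷ increasing-⊆⇒⊑ xs↑ ys↑ (All.zipWith (λ (y<z , z∈) → ∈-tail y<z z∈) (y<ys , ys∈))
increasing-⊆⇒⊑ {x ∷ xs} {y ∷ ys} (x<xs ∷ xs↑) y∷ys↑@(y<ys ∷ _) (there y∈xs ∷ ys∈) =
  x ∷ʳ increasing-⊆⇒⊑ xs↑ y∷ys↑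
         (y∈xs ∷ All.zipWith (λ (y<z , z∈) → ∈-tail (<-trans x<y y<z) z∈) (y<ys , ys∈))
  where x<y = All.lookup x<xs y∈xs

sublists : ℕ → List A → List (List A)
sublists zero    xs       = [ [] ]
sublists (suc j) []       = []
sublists (suc j) (x ∷ xs) = map (x ∷_) (sublists j xs) ++ sublists (suc j) xs

∈-sublists⁺ : {ys xs : List A} → ys ⊑ xs → ys ∈ sublists (length ys) xs
∈-sublists⁺ []                      = here refl
∈-sublists⁺ {ys = []}    (x ∷ʳ τ)   = here refl
∈-sublists⁺ {ys = _ ∷ _} (x ∷ʳ τ)   = ∈-++⁺ʳ (map (x ∷_) _) (∈-sublists⁺ τ)
∈-sublists⁺ {ys = y ∷ _} (refl ∷ τ) = ∈-++⁺ˡ (∈-map⁺ (y ∷_) (∈-sublists⁺ τ))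

∈-sublists⁻ : ∀ j (xs : List A) {ys} → ys ∈ sublists j xs → ys ⊑ xs × length ys ≡ j
∈-sublists⁻ zero    xs       (here refl) = []⊆-universal xs , refl
∈-sublists⁻ (suc j) (x ∷ xs) ys∈ with ∈-++⁻ (map (x ∷_) (sublists j xs)) ys∈
... | inj₁ ys∈map with zs , zs∈ , refl ← ∈-map⁻ (x ∷_) ys∈map
                  with τ , refl ← ∈-sublists⁻ j xs zs∈ = refl ∷ τ , refl
... | inj₂ ys∈rest with τ , len ← ∈-sublists⁻ (suc j) xs ys∈rest = x ∷ʳ τ , len

sublists-mono : ∀ j {xs ys : List A} → xs ⊑ ys → sublists j xs ⊆ sublists j ys
sublists-mono j τ S∈ with σ , refl ← ∈-sublists⁻ j _ S∈ = ∈-sublists⁺ (⊆-trans σ τ)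

length-sublists : ∀ j (xs : List A) → length (sublists j xs) ≤ length xs ^ j
length-sublists zero    xs       = ≤-refl
length-sublists (suc j) []       = z≤n
length-sublists (suc j) (x ∷ xs) = begin
  length (map (x ∷_) (sublists j xs) ++ sublists (suc j) xs)
    ≡⟨ length-++ (map (x ∷_) (sublists j xs)) ⟩
  length (map (x ∷_) (sublists j xs)) + length (sublists (suc j) xs)
    ≡⟨ cong (_+ _) (length-map (x ∷_) (sublists j xs)) ⟩
  length (sublists j xs) + length (sublists (suc j) xs)
    ≤⟨ +-mono-≤ (length-sublists j xs) (length-sublists (suc j) xs) ⟩
  m ^ j + m * m ^ j
    ≤⟨ +-mono-≤ (^-monoˡ-≤ j (n≤1+n m)) (*-monoʳ-≤ m (^-monoˡ-≤ j (n≤1+n m))) ⟩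
  suc m ^ j + m * suc m ^ j
    ∎
  where
  open ≤-Reasoning
  m = length xs

^[2k∸4]≡^[k∸2]² : ∀ n k → n ^ (2 * k ∸ 4) ≡ n ^ (k ∸ 2) * n ^ (k ∸ 2)
^[2k∸4]≡^[k∸2]² n k = begin
  n ^ (2 * k ∸ 4)            ≡⟨ cong (n ^_) (sym (*-distribˡ-∸ 2 k 2)) ⟩
  n ^ (2 * (k ∸ 2))          ≡⟨ cong (λ m → n ^ (k ∸ 2 + m)) (+-identityʳ (k ∸ 2)) ⟩
  n ^ ((k ∸ 2) + (k ∸ 2))    ≡⟨ ^-distribˡ-+-* n (k ∸ 2) (k ∸ 2) ⟩
  n ^ (k ∸ 2) * n ^ (k ∸ 2)  ∎
  where open ≡-Reasoning

bounds-by-4N : ∀ {n N} → 1 ≤ n → n ≤ N →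
               suc n + N ≤ 4 * N × suc N ≤ 4 * N × suc ((suc n + N) * N) ≤ 4 * (N * N)
bounds-by-4N {n} {N} 1≤n n≤N = a≤4N , ≤-trans (s≤s (m≤n+m N n)) a≤4N , aN<4N²
  where
  open ≤-Reasoning
  1≤N = ≤-trans 1≤n n≤N
  a≤3N : suc n + N ≤ 3 * N
  a≤3N = begin
    suc n + N    ≤⟨ +-monoˡ-≤ N (+-mono-≤ 1≤N n≤N) ⟩
    (N + N) + N  ≡⟨ +-assoc N N N ⟩
    N + (N + N)  ≡⟨ cong (λ m → N + (N + m)) (sym (+-identityʳ N)) ⟩
    3 * N        ∎
  a≤4N = ≤-trans a≤3N (*-monoˡ-≤ N (n≤1+n 3))
  aN<4N² : suc ((suc n + N) * N) ≤ 4 * (N * N)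
  aN<4N² = begin
    suc ((suc n + N) * N)  ≤⟨ +-mono-≤ (*-mono-≤ 1≤N 1≤N) (*-monoˡ-≤ N a≤3N) ⟩
    N * N + 3 * N * N      ≡⟨ cong (N * N +_) (*-assoc 3 N N) ⟩
    4 * (N * N)            ∎

Colouring : Set
Colouring = List (Edge × Colour)

drawn : Colouring → List Edge
drawn = map proj₁

drawn-snoc : ∀ E e → drawn (E ++ [ e ]) ≡ drawn E ++ [ proj₁ e ]
drawn-snoc E e = map-++ proj₁ E [ e ]

∸1≡suc∸2 : ∀ {k} → 2 ≤ k → k ∸ 1 ≡ suc (k ∸ 2)
∸1≡suc∸2 (s≤s (s≤s _)) = refl

step-reveal : ∀ k B P st → B st ≡ reveal → step k B P st ≡ mkState (suc (nv st)) (edges st)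
step-reveal k B P st B≡ rewrite B≡ = refl

step-draw : ∀ k B P st {S} → B st ≡ draw S → T (legal k st S) →
            step k B P st ≡ mkState (nv st) (edges st ++ [ (newEdge st S , P st (newEdge st S)) ])
step-draw k B P st {S} B≡ legal rewrite B≡ | Equivalence.to T-≡ legal = refl

legal⁺ : ∀ k st S → Increasing S → length S ≡ k ∸ 2 → All (_< nv st ∸ 1) S →
         newEdge st S ∉ drawn (edges st) → T (legal k st S)
legal⁺ k st S S↑ |S| S< fresh =
  ∧-intro (fromWitness {a? = allPairs? _<?_ S} S↑)
    (∧-intro (≡⇒≡ᵇ _ _ |S|) (∧-intro (All.all⁻ _ (All.map <⇒<ᵇ S<)) (not-intro undrawn)))
  where
  ∧-intro : ∀ {a b} → T a → T b → T (a ∧ b)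
  ∧-intro ta tb = Equivalence.from T-∧ (ta , tb)
  not-intro : ∀ {b} → ¬ T b → T (not b)
  not-intro {false} _  = _
  not-intro {true}  ¬t = ¬t _
  undrawn : ¬ T (any (λ p → ⌊ ≡-dec _≟_ (proj₁ p) (newEdge st S) ⌋) (edges st))
  undrawn isDrawn with (e , _) , e∈ , e≡ ← find (Any.any⁻ _ (edges st) isDrawn) =
    fresh (subst (_∈ _) (toWitness e≡) (∈-map⁺ proj₁ e∈))

blueK-zero : ∀ {k} → 2 ≤ k → ∀ st → BlueK k 0 st
blueK-zero {k} k≥2 st = [] , [] , refl , [] , no-edge
  where
  no-edge : ∀ e → Increasing e → length e ≡ k ∸ 1 → All (_∈ []) e → (e , blue) ∈ edges st
  no-edge []      _ |e| _        = contradiction (trans |e| (∸1≡suc∸2 k≥2)) λ ()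
  no-edge (_ ∷ _) _ _   (() ∷ _)

-- Red edges and red-free vertices

-- The decision procedure of `redCount`, so that `redCount≡` is `length-map`.
isRed? : (p : Edge × Colour) → Dec (isRed (proj₂ p) ≡ true)
isRed? p = isRed (proj₂ p) Bool.≟ true

redEdges : Colouring → List Edge
redEdges E = map proj₁ (filter isRed? E)

redCount≡ : ∀ m E → redCount (mkState m E) ≡ length (redEdges E)
redCount≡ m E = sym (length-map proj₁ (filter isRed? E))

∈-redEdges⁺ : ∀ {e E} → (e , red) ∈ E → e ∈ redEdges E
∈-redEdges⁺ e∈ = ∈-map⁺ proj₁ (∈-filter⁺ isRed? e∈ refl)

∈-redEdges⁻ : ∀ E {e} → e ∈ redEdges E → (e , red) ∈ E
∈-redEdges⁻ E e∈ with ∈-map⁻ proj₁ e∈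
... | (_ , red)  , p∈ , refl = proj₁ (∈-filter⁻ isRed? {xs = E} p∈)
... | (_ , blue) , p∈ , refl with () ← proj₂ (∈-filter⁻ isRed? {xs = E} p∈)

redEdges-blue : ∀ E e → redEdges (E ++ [ (e , blue) ]) ≡ redEdges E
redEdges-blue E e rewrite filter-++ isRed? E [ (e , blue) ] | ++-identityʳ (filter isRed? E) = refl

redEdges-red : ∀ E e → redEdges (E ++ [ (e , red) ]) ≡ redEdges E ++ [ e ]
redEdges-red E e rewrite filter-++ isRed? E [ (e , red) ] = map-++ proj₁ (filter isRed? E) _

RedAt : Colouring → ℕ → Set
RedAt E u = Any (λ e → last e ≡ just u) (redEdges E)

redAt? : ∀ E u → Dec (RedAt E u)
redAt? E u = any? (λ e → Maybe.≡-dec _≟_ (last e) (just u)) (redEdges E)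

RedAt⁺ : ∀ {E S u} → (S ++ [ u ] , red) ∈ E → RedAt E u
RedAt⁺ {S = S} {u} e∈ = lose (∈-redEdges⁺ e∈) (last-snoc S u)

RedAt-blue : ∀ E e u → RedAt E u ⇔ RedAt (E ++ [ (e , blue) ]) u
RedAt-blue E e u rewrite redEdges-blue E e = mk⇔ (λ r → r) (λ r → r)

RedAt-red : ∀ E S {u v} → u ≢ v → RedAt E u ⇔ RedAt (E ++ [ (S ++ [ v ] , red) ]) u
RedAt-red E S {u} {v} u≢v rewrite redEdges-red E (S ++ [ v ]) = mk⇔ Any.++⁺ˡ from
  where
  from : Any (λ e → last e ≡ just u) (redEdges E ++ [ S ++ [ v ] ]) → RedAt E u
  from r with Any.++⁻ (redEdges E) r
  ... | inj₁ r′           = r′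
  ... | inj₂ (here last≡) = contradiction (last-snoc-injective S last≡) (u≢v ∘ sym)

redFree : Colouring → ℕ → List ℕ
redFree E v = filter (¬? ∘ redAt? E) (upTo v)

∈-redFree⁺ : ∀ E {u v} → u < v → ¬ RedAt E u → u ∈ redFree E v
∈-redFree⁺ E u<v ¬redAt = ∈-filter⁺ (¬? ∘ redAt? E) (∈-upTo⁺ u<v) ¬redAt

∈-redFree⁻ : ∀ E {u v} → u ∈ redFree E v → u < v × ¬ RedAt E u
∈-redFree⁻ E {v = v} u∈ with u∈upTo , ¬redAt ← ∈-filter⁻ (¬? ∘ redAt? E) {xs = upTo v} u∈ =
  ∈-upTo⁻ u∈upTo , ¬redAt

redFree-increasing : ∀ E v → Increasing (redFree E v)
redFree-increasing E v = AllPairs.filter⁺ (¬? ∘ redAt? E) (AllPairs.applyUpTo⁺₁ (λ i → i) v (λ i<j _ → i<j))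

redFree-suc : ∀ E v → redFree E (suc v) ≡ redFree E v ++ filter (¬? ∘ redAt? E) [ v ]
redFree-suc E v = trans (cong (filter (¬? ∘ redAt? E)) (sym (upTo-∷ʳ v))) (filter-++ (¬? ∘ redAt? E) (upTo v) [ v ])

redFree-suc-free : ∀ E v → ¬ RedAt E v → redFree E (suc v) ≡ redFree E v ++ [ v ]
redFree-suc-free E v ¬redAt =
  trans (redFree-suc E v) (cong (redFree E v ++_) (filter-accept (¬? ∘ redAt? E) ¬redAt))

redFree-suc-red : ∀ E v → RedAt E v → redFree E (suc v) ≡ redFree E v
redFree-suc-red E v redAt =
  trans (redFree-suc E v) (trans (cong (redFree E v ++_) (filter-reject (¬? ∘ redAt? E) (λ ¬redAt → ¬redAt redAt)))
                                 (++-identityʳ (redFree E v)))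

redFree-⊑-suc : ∀ E v → redFree E v ⊑ redFree E (suc v)
redFree-⊑-suc E v with redAt? E v
... | yes redAt = subst (redFree E v ⊑_) (sym (redFree-suc-red E v redAt)) ⊆-refl
... | no ¬redAt = subst (redFree E v ⊑_) (sym (redFree-suc-free E v ¬redAt)) (++⁺ʳ [ v ] ⊆-refl)

length-redFree-suc : ∀ E v → length (redFree E (suc v)) ≤ suc (length (redFree E v))
length-redFree-suc E v with redAt? E v
... | yes redAt rewrite redFree-suc-red E v redAt   = n≤1+n _
... | no ¬redAt rewrite redFree-suc-free E v ¬redAt = ≤-reflexive (length-snoc (redFree E v))

redFree-cong : ∀ E E′ v → (∀ {u} → u < v → RedAt E u ⇔ RedAt E′ u) → redFree E v ≡ redFree E′ v
redFree-cong E E′ v red⇔ = filter-≐-on (¬? ∘ redAt? E) (¬? ∘ redAt? E′) (All.tabulate λ u∈ →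
  let open Equivalence (red⇔ (∈-upTo⁻ u∈)) in mk⇔ (λ ¬r r → ¬r (from r)) (λ ¬r r → ¬r (to r)))

redFree-blue : ∀ E e v → redFree (E ++ [ (e , blue) ]) v ≡ redFree E v
redFree-blue E e v = sym (redFree-cong E (E ++ [ (e , blue) ]) v (λ {u} _ → RedAt-blue E e u))

redFree-red : ∀ E S {u v} → u ≤ v → redFree (E ++ [ (S ++ [ v ] , red) ]) u ≡ redFree E u
redFree-red E S {u} {v} u≤v =
  sym (redFree-cong E (E ++ [ (S ++ [ v ] , red) ]) u (λ w<u → RedAt-red E S (<⇒≢ (<-≤-trans w<u u≤v))))

-- The strategy

module Strategy (k : ℕ) where

  candidates : Colouring → ℕ → List (List ℕ)
  candidates E v = sublists (k ∸ 2) (redFree E v)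

  ∈-candidates⁺ : ∀ E {v S} → Increasing S → length S ≡ k ∸ 2 → All (_∈ redFree E v) S →
                  S ∈ candidates E v
  ∈-candidates⁺ E {v} {S} S↑ |S| S⊆ =
    subst (λ j → S ∈ sublists j (redFree E v)) |S|
          (∈-sublists⁺ (increasing-⊆⇒⊑ (redFree-increasing E v) S↑ S⊆))

  ∈-candidates⁻ : ∀ E {v S} → S ∈ candidates E v → Increasing S × length S ≡ k ∸ 2 × All (_< v) S
  ∈-candidates⁻ E {v} S∈ with τ , |S| ← ∈-sublists⁻ (k ∸ 2) (redFree E v) S∈ =
    AllPairs-resp-⊒ τ (redFree-increasing E v) , |S| , All.tabulate (proj₁ ∘ ∈-redFree⁻ E ∘ Any-resp-⊆ τ)

  drawFirstNew : Colouring → ℕ → List (List ℕ) → Move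
  drawFirstNew E v []       = reveal
  drawFirstNew E v (S ∷ Ss) with S ++ [ v ] ∈? drawn E
  ... | yes _ = drawFirstNew E v Ss
  ... | no  _ = draw S

  drawFirstNew-reveal : ∀ E v Ss → drawFirstNew E v Ss ≡ reveal → All (λ S → S ++ [ v ] ∈ drawn E) Ss
  drawFirstNew-reveal E v []       _ = []
  drawFirstNew-reveal E v (S ∷ Ss) ≡reveal with S ++ [ v ] ∈? drawn E
  ... | yes S∈ = S∈ ∷ drawFirstNew-reveal E v Ss ≡reveal

  drawFirstNew-draw : ∀ E v Ss {S} → drawFirstNew E v Ss ≡ draw S → S ∈ Ss × S ++ [ v ] ∉ drawn E
  drawFirstNew-draw E v (S ∷ Ss) ≡draw with S ++ [ v ] ∈? drawn E
  ... | yes _ = let S∈ , fresh = drawFirstNew-draw E v Ss ≡draw in there S∈ , fresh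
  drawFirstNew-draw E v (S ∷ Ss) refl | no fresh = here refl , fresh

  move : ℕ → Colouring → Move
  move v E with redAt? E v
  ... | yes _ = reveal
  ... | no  _ = drawFirstNew E v (candidates E v)

  builder : Builder
  builder (mkState zero    _) = reveal
  builder (mkState (suc v) E) = move v E

  move-red : ∀ E {v} → RedAt E v → move v E ≡ reveal
  move-red E {v} redAt with redAt? E v
  ... | yes _     = refl
  ... | no ¬redAt = contradiction redAt ¬redAt

  move-free : ∀ E {v} → ¬ RedAt E v → move v E ≡ drawFirstNew E v (candidates E v)
  move-free E {v} ¬redAt with redAt? E v
  ... | yes redAt = contradiction redAt ¬redAt
  ... | no _      = refl

  -- about the state `mkState (suc v) E`, whose newest vertex is v
  record Invariant (v : ℕ) (E : Colouring) : Set where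
    field
      shaped           : ∀ {e c} → (e , c) ∈ E →
                         ∃₂ λ S u → e ≡ S ++ [ u ] × u ≤ v × All (_< u) S × S ∈ candidates E v
      drawnOnce        : Unique (drawn E)
      -- a repeated base would be a red F
      redBasesDistinct : Unique (map dropLast (redEdges E))
      -- each vertex ≤ v is red-free or the top of a red edge, and no vertex tops two red edges
      counted          : suc v ≤ length (redFree E (suc v)) + length (redEdges E)
      saturated        : ∀ {u} → u < v → ¬ RedAt E u → All (λ S → S ++ [ u ] ∈ drawn E) (candidates E u)
  open Invariant

  invariant₀ : Invariant 0 []
  invariant₀ = record
    { shaped = λ () ; drawnOnce = [] ; redBasesDistinct = [] ; counted = ≤-refl ; saturated = λ () }

  RedAt⇒≤ : ∀ {v E w} → Invariant v E → RedAt E w → w ≤ v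
  RedAt⇒≤ {E = E} I redAt with e , e∈ , last≡ ← find redAt
                          with S , u , refl , u≤v , _ ← shaped I (∈-redEdges⁻ E e∈) =
    subst (_≤ _) (last-snoc-injective S last≡) u≤v

  reveal-preserves : ∀ {v E} → Invariant v E →
                     (¬ RedAt E v → All (λ S → S ++ [ v ] ∈ drawn E) (candidates E v)) → Invariant (suc v) E
  reveal-preserves {v} {E} I saturated-at-v = record
    { shaped           = shaped′
    ; drawnOnce        = drawnOnce I
    ; redBasesDistinct = redBasesDistinct I
    ; counted          = counted′
    ; saturated        = saturated′
    }
    where
    shaped′ : ∀ {e c} → (e , c) ∈ E →
              ∃₂ λ S u → e ≡ S ++ [ u ] × u ≤ suc v × All (_< u) S × S ∈ candidates E (suc v)
    shaped′ e∈ with S , u , e≡ , u≤v , S<u , S∈ ← shaped I e∈ =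
      S , u , e≡ , m≤n⇒m≤1+n u≤v , S<u , sublists-mono (k ∸ 2) (redFree-⊑-suc E v) S∈
    ¬redAt-suc : ¬ RedAt E (suc v)
    ¬redAt-suc redAt = 1+n≰n (RedAt⇒≤ I redAt)
    counted′ : suc (suc v) ≤ length (redFree E (suc (suc v))) + length (redEdges E)
    counted′ = begin
      suc (suc v)
        ≤⟨ s≤s (counted I) ⟩
      suc (length (redFree E (suc v))) + length (redEdges E)
        ≡⟨ cong (_+ _) (sym (length-snoc (redFree E (suc v)))) ⟩
      length (redFree E (suc v) ++ [ suc v ]) + length (redEdges E)
        ≡⟨ cong (λ Q → length Q + _) (sym (redFree-suc-free E (suc v) ¬redAt-suc)) ⟩
      length (redFree E (suc (suc v))) + length (redEdges E)
        ∎
      where open ≤-Reasoning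
    saturated′ : ∀ {u} → u < suc v → ¬ RedAt E u → All (λ S → S ++ [ u ] ∈ drawn E) (candidates E u)
    saturated′ u<1+v ¬redAt with m<1+n⇒m<n∨m≡n u<1+v
    ... | inj₁ u<v  = saturated I u<v ¬redAt
    ... | inj₂ refl = saturated-at-v ¬redAt

  module AfterDraw {v E S c} (I : Invariant v E) (S∈ : S ∈ candidates E v) (fresh : S ++ [ v ] ∉ drawn E)
                   (red⇔ : ∀ {u} → u < v → RedAt E u ⇔ RedAt (E ++ [ (S ++ [ v ] , c) ]) u) where

    private
      E′ : Colouring
      E′ = E ++ [ (S ++ [ v ] , c) ]

    redFree-unchanged : ∀ {u} → u ≤ v → redFree E′ u ≡ redFree E u
    redFree-unchanged u≤v = sym (redFree-cong E E′ _ (λ w<u → red⇔ (<-≤-trans w<u u≤v)))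

    shaped′ : ∀ {e c′} → (e , c′) ∈ E′ →
              ∃₂ λ S u → e ≡ S ++ [ u ] × u ≤ v × All (_< u) S × S ∈ candidates E′ v
    shaped′ e∈ rewrite redFree-unchanged ≤-refl with ∈-++⁻ E e∈
    ... | inj₁ e∈E         = shaped I e∈E
    ... | inj₂ (here refl) = S , v , refl , ≤-refl , proj₂ (proj₂ (∈-candidates⁻ E {v} S∈)) , S∈

    drawnOnce′ : Unique (drawn E′)
    drawnOnce′ = subst Unique (sym (drawn-snoc E _)) (unique-snoc (drawnOnce I) fresh)

    saturated′ : ∀ {u} → u < v → ¬ RedAt E′ u → All (λ S → S ++ [ u ] ∈ drawn E′) (candidates E′ u)
    saturated′ u<v ¬redAt rewrite redFree-unchanged (<⇒≤ u<v) =
      All.map (λ e∈ → subst (_ ∈_) (sym (drawn-snoc E (S ++ [ v ] , c))) (∈-++⁺ˡ e∈))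
              (saturated I u<v (¬redAt ∘ Equivalence.to (red⇔ u<v)))

  drawBlue-preserves : ∀ {v E S} → Invariant v E → S ∈ candidates E v → S ++ [ v ] ∉ drawn E →
                       Invariant v (E ++ [ (S ++ [ v ] , blue) ])
  drawBlue-preserves {v} {E} {S} I S∈ fresh = record
    { shaped           = shaped′
    ; drawnOnce        = drawnOnce′
    ; redBasesDistinct = subst (Unique ∘ map dropLast) (sym (redEdges-blue E _)) (redBasesDistinct I)
    ; counted          = subst₂ (λ Q R → suc v ≤ length Q + length R)
                                (sym (redFree-blue E _ (suc v))) (sym (redEdges-blue E _)) (counted I)
    ; saturated        = saturated′
    }
    where open AfterDraw I S∈ fresh (λ {u} _ → RedAt-blue E (S ++ [ v ]) u)

  drawRed-preserves : ∀ {v E S} → Invariant v E → S ∈ candidates E v → S ++ [ v ] ∉ drawn E →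
                      ¬ RedAt E v → S ∉ map dropLast (redEdges E) → Invariant v (E ++ [ (S ++ [ v ] , red) ])
  drawRed-preserves {v} {E} {S} I S∈ fresh ¬redAt newBase = record
    { shaped           = shaped′
    ; drawnOnce        = drawnOnce′
    ; redBasesDistinct = subst Unique (sym bases′) (unique-snoc (redBasesDistinct I) newBase)
    ; counted          = counted′
    ; saturated        = saturated′
    }
    where
    open AfterDraw I S∈ fresh (λ u<v → RedAt-red E S (<⇒≢ u<v))
    E′ = E ++ [ (S ++ [ v ] , red) ]
    bases′ : map dropLast (redEdges E′) ≡ map dropLast (redEdges E) ++ [ S ]
    bases′ = begin
      map dropLast (redEdges E′)                              ≡⟨ cong (map dropLast) (redEdges-red E _) ⟩
      map dropLast (redEdges E ++ [ S ++ [ v ] ])             ≡⟨ map-++ dropLast (redEdges E) _ ⟩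
      map dropLast (redEdges E) ++ [ dropLast (S ++ [ v ]) ]  ≡⟨ cong (λ B → map dropLast (redEdges E) ++ [ B ])
                                                                      (dropLast-snoc S v) ⟩
      map dropLast (redEdges E) ++ [ S ]                      ∎
      where open ≡-Reasoning
    counted′ : suc v ≤ length (redFree E′ (suc v)) + length (redEdges E′)
    counted′ = begin
      suc v
        ≤⟨ counted I ⟩
      length (redFree E (suc v)) + length (redEdges E)
        ≡⟨ cong (λ Q → length Q + _) (redFree-suc-free E v ¬redAt) ⟩
      length (redFree E v ++ [ v ]) + length (redEdges E)
        ≡⟨ cong (_+ _) (length-snoc (redFree E v)) ⟩
      suc (length (redFree E v)) + length (redEdges E)
        ≡⟨ sym (+-suc _ _) ⟩
      length (redFree E v) + suc (length (redEdges E))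
        ≡⟨ cong₂ (λ Q R → length Q + R) (sym (redFree-unchanged ≤-refl)) (sym (length-snoc (redEdges E))) ⟩
      length (redFree E′ v) + length (redEdges E ++ [ S ++ [ v ] ])
        ≡⟨ cong₂ (λ Q R → length Q + length R) (sym (redFree-suc-red E′ v (RedAt⁺ (∈-++⁺ʳ E (here refl)))))
                                               (sym (redEdges-red E _)) ⟩
      length (redFree E′ (suc v)) + length (redEdges E′)
        ∎
      where open ≤-Reasoning

  redF-found : ∀ {v E S} → Invariant v E → ¬ RedAt E v → S ∈ candidates E v → S ∈ map dropLast (redEdges E) →
               RedF k (mkState (suc v) (E ++ [ (S ++ [ v ] , red) ]))
  redF-found {v} {E} {S} I ¬redAt S∈ S∈bases
    with e , e∈ , S≡ ← ∈-map⁻ dropLast S∈bases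
    with S′ , u , refl , u≤v , S′<u , _ ← shaped I (∈-redEdges⁻ E e∈)
    with refl ← trans S≡ (dropLast-snoc S′ u)
    with S↑ , |S| , _ ← ∈-candidates⁻ E {v} S∈ =
    S , u , v , S↑ , |S| , S′<u , u<v , ∈-++⁺ˡ (∈-redEdges⁻ E e∈) , ∈-++⁺ʳ E (here refl)
    where
    u<v : u < v
    u<v = ≤∧≢⇒< u≤v (λ { refl → ¬redAt (RedAt⁺ (∈-redEdges⁻ E e∈)) })

  data Progress (P : Painter) (v : ℕ) (E : Colouring) : Set where
    continues : ∀ {v′ E′} → step k builder P (mkState (suc v) E) ≡ mkState (suc v′) E′ → Invariant v′ E′ →
                v + length E < v′ + length E′ → length (redFree E′ v′) ≤ suc (length (redFree E v)) →
                Progress P v E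
    findsRedF : ∀ {e} → step k builder P (mkState (suc v) E) ≡ mkState (suc v) (E ++ [ (e , red) ]) →
                RedF k (mkState (suc v) (E ++ [ (e , red) ])) → Progress P v E

  progress : ∀ P {v E} → Invariant v E → Progress P v E
  progress P {v} {E} I with redAt? E v
  ... | yes redAt =
    continues (step-reveal k builder P (mkState (suc v) E) (move-red E redAt))
              (reveal-preserves I (contradiction redAt)) ≤-refl (length-redFree-suc E v)
  ... | no ¬redAt with drawFirstNew E v (candidates E v) in next
  ...   | reveal =
    continues (step-reveal k builder P (mkState (suc v) E) (trans (move-free E ¬redAt) next))
              (reveal-preserves I (λ _ → drawFirstNew-reveal E v _ next)) ≤-refl (length-redFree-suc E v)
  ...   | draw S with S∈ , fresh ← drawFirstNew-draw E v _ next =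
    drawnWith (P (mkState (suc v) E) (S ++ [ v ]))
              (step-draw k builder P (mkState (suc v) E) (trans (move-free E ¬redAt) next) isLegal)
    where
    isLegal : T (legal k (mkState (suc v) E) S)
    isLegal = let S↑ , |S| , S<v = ∈-candidates⁻ E {v} S∈ in legal⁺ k (mkState (suc v) E) S S↑ |S| S<v fresh
    one-more : ∀ {c} → v + length E < v + length (E ++ [ (S ++ [ v ] , c) ])
    one-more = ≤-reflexive (trans (sym (+-suc v _)) (cong (v +_) (sym (length-snoc E))))
    drawnWith : ∀ c → step k builder P (mkState (suc v) E) ≡ mkState (suc v) (E ++ [ (S ++ [ v ] , c) ]) →
                Progress P v E
    drawnWith blue st≡ = continues st≡ (drawBlue-preserves I S∈ fresh) one-more
      (≤-trans (≤-reflexive (cong length (redFree-blue E (S ++ [ v ]) v))) (n≤1+n _))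
    drawnWith red st≡ with S ∈? map dropLast (redEdges E)
    ... | yes oldBase = findsRedF st≡ (redF-found I ¬redAt S∈ oldBase)
    ... | no newBase  = continues st≡ (drawRed-preserves I S∈ fresh ¬redAt newBase) one-more
      (≤-trans (≤-reflexive (cong length (redFree-red E S {v} ≤-refl))) (n≤1+n _))

  redEdges-bound : ∀ {v E} → Invariant v E → length (redEdges E) ≤ length (redFree E v) ^ (k ∸ 2)
  redEdges-bound {v} {E} I = begin
    length (redEdges E)                 ≡⟨ sym (length-map dropLast (redEdges E)) ⟩
    length (map dropLast (redEdges E))  ≤⟨ unique-⊆⇒length≤ (redBasesDistinct I) bases⊆candidates ⟩
    length (candidates E v)             ≤⟨ length-sublists (k ∸ 2) (redFree E v) ⟩
    length (redFree E v) ^ (k ∸ 2)      ∎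
    where
    open ≤-Reasoning
    bases⊆candidates : map dropLast (redEdges E) ⊆ candidates E v
    bases⊆candidates S∈ with e , e∈ , refl ← ∈-map⁻ dropLast S∈
                        with S , u , refl , _ , _ , S∈′ ← shaped I (∈-redEdges⁻ E e∈) =
      subst (_∈ candidates E v) (sym (dropLast-snoc S u)) S∈′

  edges-bound : ∀ {v E} → Invariant v E → length E ≤ suc v * length (redFree E v) ^ (k ∸ 2)
  edges-bound {v} {E} I = begin
    length E
      ≡⟨ sym (length-map proj₁ E) ⟩
    length (drawn E)
      ≤⟨ unique-⊆⇒length≤ (drawnOnce I) drawn⊆ ⟩
    length (cartesianProductWith snoc (candidates E v) (upTo (suc v)))
      ≡⟨ length-cartesianProductWith snoc (candidates E v) (upTo (suc v)) ⟩
    length (candidates E v) * length (upTo (suc v))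
      ≡⟨ cong (length (candidates E v) *_) (length-upTo (suc v)) ⟩
    length (candidates E v) * suc v
      ≤⟨ *-monoˡ-≤ (suc v) (length-sublists (k ∸ 2) (redFree E v)) ⟩
    length (redFree E v) ^ (k ∸ 2) * suc v
      ≡⟨ *-comm _ (suc v) ⟩
    suc v * length (redFree E v) ^ (k ∸ 2)
      ∎
    where
    open ≤-Reasoning
    snoc : List ℕ → ℕ → Edge
    snoc S u = S ++ [ u ]
    drawn⊆ : drawn E ⊆ cartesianProductWith snoc (candidates E v) (upTo (suc v))
    drawn⊆ e∈ with _ , p∈ , refl ← ∈-map⁻ proj₁ e∈
              with S , u , refl , u≤v , _ , S∈ ← shaped I p∈ =
      ∈-cartesianProductWith⁺ snoc S∈ (∈-upTo⁺ (s≤s u≤v))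

  vertices-bound : ∀ {v E} → Invariant v E → suc v ≤ suc (length (redFree E v)) + length (redFree E v) ^ (k ∸ 2)
  vertices-bound {v} {E} I = ≤-trans (counted I) (+-mono-≤ (length-redFree-suc E v) (redEdges-bound I))

  blueClique : 2 ≤ k → ∀ {v E} → Invariant v E → BlueK k (length (redFree E v)) (mkState (suc v) E)
  blueClique k≥2 {v} {E} I =
    redFree E v , redFree-increasing E v , refl ,
    All.tabulate (m<n⇒m<1+n ∘ proj₁ ∘ ∈-redFree⁻ E {v = v}) , isBlue
    where
    blue-if-free : ∀ {S u} c → ¬ RedAt E u → (S ++ [ u ] , c) ∈ E → (S ++ [ u ] , blue) ∈ E
    blue-if-free blue _      e∈ = e∈
    blue-if-free red  ¬redAt e∈ = contradiction (RedAt⁺ e∈) ¬redAt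
    isBlue : ∀ e → Increasing e → length e ≡ k ∸ 1 → All (_∈ redFree E v) e → (e , blue) ∈ E
    isBlue e e↑ |e| e⊆ with initLast e
    ... | [] = contradiction (trans |e| (∸1≡suc∸2 k≥2)) λ ()
    ... | S ∷ʳ′ u with S↑ , S<u ← AllPairs-snoc⁻ S e↑
                  with u<v , ¬redAt ← ∈-redFree⁻ E {v = v} (All.head (All.++⁻ʳ S e⊆)) =
      let |S|     = suc-injective (trans (sym (length-snoc S)) (trans |e| (∸1≡suc∸2 k≥2)))
          S⊆      = All.zipWith (λ (w<u , w∈) → ∈-redFree⁺ E {v = u} w<u (proj₂ (∈-redFree⁻ E {v = v} w∈)))
                                (S<u , All.++⁻ˡ S e⊆)
          S∪u∈    = All.lookup (saturated I u<v ¬redAt) (∈-candidates⁺ E {u} S↑ |S| S⊆)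
          (_ , c) , e∈ , e≡ = ∈-map⁻ proj₁ S∪u∈
      in blue-if-free c ¬redAt (subst (λ e → (e , c) ∈ E) (sym e≡) e∈)

  module Play (k≥3 : 3 ≤ k) (n : ℕ) where

    N : ℕ
    N = n ^ (k ∸ 2)

    n≤N : 1 ≤ n → n ≤ N
    n≤N 1≤n = ≤-trans (≤-reflexive (sym (*-identityʳ n)))
                      (^-monoʳ-≤ n {{>-nonZero 1≤n}} (∸-monoˡ-≤ 2 k≥3))

    Success : State → Set
    Success st = (RedF k st ⊎ BlueK k n st)
               × nv st ≤ suc n + N × redCount st ≤ suc N × length (edges st) ≤ suc ((suc n + N) * N)

    bounded : ∀ {v E} → Invariant v E → length (redFree E v) ≤ n →
              suc v ≤ suc n + N × length (redEdges E) ≤ N × length E ≤ (suc n + N) * N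
    bounded {v} {E} I q≤n =
      v≤ , ≤-trans (redEdges-bound I) q^j≤N , ≤-trans (edges-bound I) (*-mono-≤ v≤ q^j≤N)
      where
      q^j≤N = ^-monoˡ-≤ (k ∸ 2) q≤n
      v≤    = ≤-trans (vertices-bound I) (+-mono-≤ (s≤s q≤n) q^j≤N)

    potential< : ∀ {v E} → Invariant v E → length (redFree E v) ≤ n → v + length E < suc n + N + (suc n + N) * N
    potential< I q≤n = let v≤ , _ , e≤ = bounded I q≤n in +-mono-≤ v≤ e≤

    -- every move increases v + length E, which `potential<` bounds: `fuel` counts the moves left
    wins-from : ∀ P fuel {t v E} → run k builder P t ≡ mkState (suc v) E → Invariant v E →
                length (redFree E v) ≤ n → suc n + N + (suc n + N) * N ≤ fuel + (v + length E) →
                ∃[ t ] Success (run k builder P t)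
    wins-from P fuel {t} {v} {E} run≡ I q≤n enough with bounded I q≤n | n ≤? length (redFree E v)
    ... | v≤ , r≤ , e≤ | yes n≤q =
      t , subst Success (sym run≡)
        ( inj₂ (subst (λ m → BlueK k m (mkState (suc v) E)) (≤-antisym q≤n n≤q) (blueClique (<⇒≤ k≥3) I))
        , v≤ , subst (_≤ suc N) (sym (redCount≡ (suc v) E)) (m≤n⇒m≤1+n r≤) , m≤n⇒m≤1+n e≤ )
    ... | v≤ , r≤ , e≤ | no q≱n with progress P I
    ...   | findsRedF {e} st≡ redF =
      suc t , subst Success (sym (trans (cong (step k builder P) run≡) st≡))
        ( inj₁ redF , v≤
        , subst (_≤ suc N) (sym redCount′) (s≤s r≤)
        , subst (_≤ suc ((suc n + N) * N)) (sym (length-snoc E)) (s≤s e≤) )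
      where
      redCount′ : redCount (mkState (suc v) (E ++ [ (e , red) ])) ≡ suc (length (redEdges E))
      redCount′ = trans (redCount≡ (suc v) (E ++ [ (e , red) ]))
                        (trans (cong length (redEdges-red E e)) (length-snoc (redEdges E)))
    ...   | continues {v′} {E′} st≡ I′ grows q′≤ with fuel
    ...     | zero = contradiction (≤-<-trans enough (<-trans grows (potential< I′ q′≤n))) (<-irrefl refl)
      where q′≤n = ≤-trans q′≤ (≰⇒> q≱n)
    ...     | suc fuel′ =
      wins-from P fuel′ {suc t} (trans (cong (step k builder P) run≡) st≡) I′ (≤-trans q′≤ (≰⇒> q≱n))
                (≤-trans enough (≤-trans (≤-reflexive (sym (+-suc fuel′ _))) (+-monoʳ-≤ fuel′ grows)))

    wins : ∀ P → ∃[ t ] Success (run k builder P t)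
    wins P = wins-from P (suc n + N + (suc n + N) * N) {1} refl invariant₀ z≤n (≤-reflexive (sym (+-identityʳ _)))

    wins-within-4N : 1 ≤ n → ∀ P → ∃[ t ] ((RedF k (run k builder P t) ⊎ BlueK k n (run k builder P t))
                       × nv (run k builder P t) ≤ 4 * N × redCount (run k builder P t) ≤ 4 * N
                       × length (edges (run k builder P t)) ≤ 4 * n ^ (2 * k ∸ 4))
    wins-within-4N 1≤n P with t , outcome , nv≤ , red≤ , edges≤ ← wins P
                         with nv≤′ , red≤′ , edges≤′ ← bounds-by-4N 1≤n (n≤N 1≤n) =
      t , outcome , ≤-trans nv≤ nv≤′ , ≤-trans red≤ red≤′
        , subst (λ m → length (edges (run k builder P t)) ≤ 4 * m) (sym (^[2k∸4]≡^[k∸2]² n k))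
                (≤-trans edges≤ edges≤′)

theorem2p1 : ∀ (k : ℕ) → 3 ≤ k →
  ∃[ C ] ∀ (n : ℕ) → ∃[ B ] ∀ (P : Painter) → ∃[ t ]
    ((RedF k (run k B P t) ⊎ BlueK k n (run k B P t))
     × nv (run k B P t) ≤ C * n ^ (k ∸ 2)
     × redCount (run k B P t) ≤ C * n ^ (k ∸ 2)
     × length (edges (run k B P t)) ≤ C * n ^ (2 * k ∸ 4))
theorem2p1 k k≥3 = 4 , λ where
    zero    → builder , λ P → 0 , inj₂ (blueK-zero (<⇒≤ k≥3) initial) , z≤n , z≤n , z≤n
    (suc n) → builder , Play.wins-within-4N k≥3 (suc n) (s≤s z≤n)
  where open Strategy k
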